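{- Let $n \ge 2$ and let $\mathcal{F}$ be a $2$-laminar family with $\mathcal{F} \subseteq \{A \subseteq [n] : |A| \ge 2\}$. Let $\mathcal{F}^*$ be the set of maximal (under inclusion) elements of $\mathcal{F} \setminus \{[n]\}$, and for each $k$ let $b_k$ be the number of elements of $\mathcal{F}^*$ of cardinality $k$. Then $$|\mathcal{F}| \le 1 + \sum_{2 \le k < n} f(k)\, b_k.$$
   Context: $[n]=\{1,\dots,n\}$. A family $\mathcal{F}$ of subsets of a set is $2$-laminar if whenever $A,B \in \mathcal{F}$ satisfy $|A \cap B| \ge 2$, we have $A \subseteq B$ or $B \subseteq A$. For a positive integer $k$, $f(k)$ denotes the maximum of $|\{A \in \mathcal{G} : |A| \ge 2\}|$ over all $2$-laminar families $\mathcal{G}$ of subsets of $[k]$. -}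

module Defs where

open import Data.Nat using (ℕ; _≤_; _*_; _≟_)
open import Data.Bool using (Bool)
import Data.Bool as B
open import Data.Fin.Subset using (Subset; _⊆_; _∩_; ∣_∣; ⊤)
open import Data.Fin.Subset.Properties using (_⊆?_)
open import Data.Vec.Properties using (≡-dec)
open import Data.List using (List; length; filter; map; upTo; drop)
open import Data.Nat.ListAction using (sum)
open import Data.List.Membership.Propositional using (_∈_)
open import Data.List.Relation.Unary.All using (All; all?)
open import Data.List.Relation.Unary.Unique.Propositional using (Unique)
open import Data.Product using (_×_; ∃)
open import Data.Sum using (_⊎_)
open import Relation.Nullary using (¬_; Dec; ¬?)
open import Relation.Nullary.Decidable using (_×-dec_; _⊎-dec_)
open import Relation.Binary.PropositionalEquality using (_≡_)

-- A family of subsets of [n] = Fin n is a duplicate-free list of subsets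
-- (the family's cardinality is the length of the list).

TwoLaminar : ∀ {n} → List (Subset n) → Set
TwoLaminar F = ∀ {A B} → A ∈ F → B ∈ F → 2 ≤ ∣ A ∩ B ∣ → A ⊆ B ⊎ B ⊆ A

countLarge : ∀ {n} → List (Subset n) → ℕ
countLarge G = length (filter (λ A → 2 Data.Nat.≤? ∣ A ∣) G)

-- g k is the maximum of countLarge G over 2-laminar families G of subsets of [k],
-- i.e. g k = f(k) (the maximum exists since there are finitely many families).
IsMaxLaminar : ℕ → ℕ → Set
IsMaxLaminar k m =
  (∀ (G : List (Subset k)) → Unique G → TwoLaminar G → countLarge G ≤ m)
  × ∃ (λ (G : List (Subset k)) → Unique G × TwoLaminar G × countLarge G ≡ m)

IsF : (ℕ → ℕ) → Set
IsF g = ∀ k → IsMaxLaminar k (g k)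

_≟S_ : ∀ {n} (A B : Subset n) → Dec (A ≡ B)
_≟S_ = ≡-dec B._≟_

MaximalNonTop : ∀ {n} → List (Subset n) → Subset n → Set
MaximalNonTop F A = ¬ (A ≡ ⊤) × All (λ B → B ≡ ⊤ ⊎ (¬ (A ⊆ B) ⊎ B ≡ A)) F

maximalNonTop? : ∀ {n} (F : List (Subset n)) (A : Subset n) → Dec (MaximalNonTop F A)
maximalNonTop? F A =
  ¬? (A ≟S ⊤) ×-dec all? (λ B → (B ≟S ⊤) ⊎-dec (¬? (A ⊆? B) ⊎-dec (B ≟S A))) F

Fstar : ∀ {n} → List (Subset n) → List (Subset n)
Fstar F = filter (maximalNonTop? F) F

b : ∀ {n} → List (Subset n) → ℕ → ℕ
b F k = length (filter (λ A → ∣ A ∣ ≟ k) (Fstar F))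

sum2≤k<n : ℕ → (ℕ → ℕ) → ℕ
sum2≤k<n n h = sum (map h (drop 2 (upTo n)))

-- Every member of F other than [n] lies inside a maximal one, M ∈ F*. The members inside M,
-- read as subsets of the |M| points of M, form a 2-laminar family of subsets of [|M|] of size
-- at least 2, so there are at most f(|M|) of them. Hence |F| ≤ 1 + Σ_{M ∈ F*} f(|M|), and
-- grouping the M ∈ F* by size (2 ≤ |M| < n) gives the bound.
module Submission where

open import Defs
open import Data.Nat using (ℕ; _≤_; _+_; _*_)
open import Data.List using (List; length)
open import Data.List.Relation.Unary.All using (All)
open import Data.List.Relation.Unary.Unique.Propositional using (Unique)
open import Data.Fin.Subset using (Subset; ∣_∣)

open import Data.Bool using (_∧_)
open import Data.Empty using (⊥-elim)
open import Data.Fin.Subset using (_⊆_; _∩_; ⊤; inside; outside)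
open import Data.Fin.Subset.Properties
  using (drop-∷-⊆; p⊆q⇒∣p∣≤∣q∣; ∣p∣≤n; ∣p∣≡n⇒p≡⊤; ⊆-refl; ⊆-trans; _⊆?_)
open import Data.List using ([]; _∷_; map; filter; drop; upTo)
open import Data.List.Extrema.Nat using (argmax; argmax-all; f[xs]≤f[argmax])
open import Data.List.Membership.Propositional using (_∈_; lose)
open import Data.List.Membership.Propositional.Properties
  using (∈-map⁺; ∈-filter⁺; ∈-filter⁻; ∈-applyUpTo⁺)
open import Data.List.Properties
  using (map-∘; map-cong; map-id-local; length-map; filter-all; filter-accept)
open import Data.List.Relation.Unary.All as All using ([]; _∷_)
open import Data.List.Relation.Unary.All.Properties using (gmap⁻; all-filter; filter⁺)
open import Data.List.Relation.Unary.AllPairs using ([]; _∷_)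
open import Data.List.Relation.Unary.Any using (Any; here; there)
import Data.List.Relation.Unary.Unique.Propositional.Properties as Unique
open import Data.Nat using (suc; z≤n; s≤s; _<_; _≟_; _≤?_)
open import Data.Nat.ListAction using (sum)
open import Data.Nat.Properties
open import Algebra.Properties.CommutativeSemigroup +-commutativeSemigroup using (x∙yz≈y∙xz)
open import Data.Product using (∃; _×_; _,_; proj₁; proj₂)
import Data.Sum as Sum
open import Data.Sum using (_⊎_; inj₁; inj₂)
open import Data.Vec using ([]; _∷_; here; there)
open import Function using (_∘_)
open import Relation.Binary using (DecidableEquality)
open import Relation.Binary.PropositionalEquality
  using (_≡_; _≢_; refl; sym; trans; cong; cong₂; subst; module ≡-Reasoning)
open import Relation.Nullary using (¬_; Dec; yes; no; ¬?)
open import Relation.Nullary.Decidable using (_×-dec_)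

-- Subset ∣ M ∣ indexes the points of M in increasing order.
restrict : ∀ {n} (M : Subset n) → Subset n → Subset ∣ M ∣
restrict []            []      = []
restrict (inside  ∷ M) (x ∷ A) = x ∷ restrict M A
restrict (outside ∷ M) (_ ∷ A) = restrict M A

embed : ∀ {n} (M : Subset n) → Subset ∣ M ∣ → Subset n
embed []            []      = []
embed (inside  ∷ M) (x ∷ A) = x ∷ embed M A
embed (outside ∷ M) A       = outside ∷ embed M A

embed-restrict : ∀ {n} (M : Subset n) {A} → A ⊆ M → embed M (restrict M A) ≡ A
embed-restrict []            {[]}          _   = refl
embed-restrict (inside  ∷ M) {x ∷ A}       A⊆M = cong (x ∷_) (embed-restrict M (drop-∷-⊆ A⊆M))
embed-restrict (outside ∷ M) {outside ∷ A} A⊆M = cong (outside ∷_) (embed-restrict M (drop-∷-⊆ A⊆M))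
embed-restrict (outside ∷ M) {inside  ∷ A} A⊆M with () ← A⊆M here

∣embed∣ : ∀ {n} (M : Subset n) A → ∣ embed M A ∣ ≡ ∣ A ∣
∣embed∣ []            []            = refl
∣embed∣ (inside  ∷ M) (inside  ∷ A) = cong suc (∣embed∣ M A)
∣embed∣ (inside  ∷ M) (outside ∷ A) = ∣embed∣ M A
∣embed∣ (outside ∷ M) A             = ∣embed∣ M A

embed-∩ : ∀ {n} (M : Subset n) A B → embed M (A ∩ B) ≡ embed M A ∩ embed M B
embed-∩ []            []      []      = refl
embed-∩ (inside  ∷ M) (x ∷ A) (y ∷ B) = cong (x ∧ y ∷_) (embed-∩ M A B)
embed-∩ (outside ∷ M) A       B       = cong (outside ∷_) (embed-∩ M A B)

embed-⊆⁻ : ∀ {n} (M : Subset n) {A B} → embed M A ⊆ embed M B → A ⊆ B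
embed-⊆⁻ (inside  ∷ M) {_ ∷ _} {_ ∷ _} s here with s here
... | here = here
embed-⊆⁻ (inside  ∷ M) {_ ∷ _} {_ ∷ _} s (there x∈A) = there (embed-⊆⁻ M (drop-∷-⊆ s) x∈A)
embed-⊆⁻ (outside ∷ M) s = embed-⊆⁻ M (drop-∷-⊆ s)

p⊆q∧∣q∣≤∣p∣⇒p≡q : ∀ {n} {p q : Subset n} → p ⊆ q → ∣ q ∣ ≤ ∣ p ∣ → p ≡ q
p⊆q∧∣q∣≤∣p∣⇒p≡q {p = []}          {[]}          _   _ = refl
p⊆q∧∣q∣≤∣p∣⇒p≡q {p = inside  ∷ p} {inside  ∷ q} p⊆q (s≤s ∣q∣≤∣p∣) =
  cong (inside ∷_) (p⊆q∧∣q∣≤∣p∣⇒p≡q (drop-∷-⊆ p⊆q) ∣q∣≤∣p∣)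
p⊆q∧∣q∣≤∣p∣⇒p≡q {p = outside ∷ p} {outside ∷ q} p⊆q ∣q∣≤∣p∣ =
  cong (outside ∷_) (p⊆q∧∣q∣≤∣p∣⇒p≡q (drop-∷-⊆ p⊆q) ∣q∣≤∣p∣)
p⊆q∧∣q∣≤∣p∣⇒p≡q {p = inside  ∷ p} {outside ∷ q} p⊆q _ with () ← p⊆q here
p⊆q∧∣q∣≤∣p∣⇒p≡q {p = outside ∷ p} {inside  ∷ q} p⊆q ∣q∣<∣p∣ =
  ⊥-elim (<-irrefl refl (≤-trans ∣q∣<∣p∣ (p⊆q⇒∣p∣≤∣q∣ (drop-∷-⊆ p⊆q))))

p≢⊤⇒∣p∣<n : ∀ {n} (p : Subset n) → p ≢ ⊤ → ∣ p ∣ < n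
p≢⊤⇒∣p∣<n p p≢⊤ = ≤∧≢⇒< (∣p∣≤n p) (p≢⊤ ∘ ∣p∣≡n⇒p≡⊤)

⊆-family⇒embedding : ∀ {n} (M : Subset n) {L : List (Subset n)} →
  All (_⊆ M) L → ∃ λ (G : List (Subset ∣ M ∣)) → map (embed M) G ≡ L
⊆-family⇒embedding M {L} L⊆M = map (restrict M) L , (begin
  map (embed M) (map (restrict M) L) ≡⟨ map-∘ L ⟨
  map (embed M ∘ restrict M) L       ≡⟨ map-id-local (All.map (embed-restrict M) L⊆M) ⟩
  L                                  ∎)
  where open ≡-Reasoning

TwoLaminar-filter : ∀ {n} {P : Subset n → Set} (P? : ∀ A → Dec (P A)) {F : List (Subset n)} →
  TwoLaminar F → TwoLaminar (filter P? F)
TwoLaminar-filter P? {F} lam A∈ B∈ =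
  lam (proj₁ (∈-filter⁻ P? {xs = F} A∈)) (proj₁ (∈-filter⁻ P? {xs = F} B∈))

TwoLaminar-embed⁻ : ∀ {n} (M : Subset n) {G : List (Subset ∣ M ∣)} →
  TwoLaminar (map (embed M) G) → TwoLaminar G
TwoLaminar-embed⁻ M lam {A} {B} A∈G B∈G 2≤∣A∩B∣ =
  Sum.map (embed-⊆⁻ M) (embed-⊆⁻ M) (lam (∈-map⁺ (embed M) A∈G) (∈-map⁺ (embed M) B∈G) 2≤∣A′∩B′∣)
  where
  2≤∣A′∩B′∣ : 2 ≤ ∣ embed M A ∩ embed M B ∣
  2≤∣A′∩B′∣ = subst (λ C → 2 ≤ ∣ C ∣) (embed-∩ M A B)
                (subst (2 ≤_) (sym (∣embed∣ M (A ∩ B))) 2≤∣A∩B∣)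

TwoLaminar-⊆⇒length≤ : ∀ {n m} (M : Subset n) → IsMaxLaminar ∣ M ∣ m → {L : List (Subset n)} →
  Unique L → TwoLaminar L → All (λ A → 2 ≤ ∣ A ∣) L → All (_⊆ M) L → length L ≤ m
TwoLaminar-⊆⇒length≤ {m = m} M (bound , _) uL lamL bigL L⊆M with ⊆-family⇒embedding M L⊆M
... | G , refl = begin
  length (map (embed M) G) ≡⟨ length-map (embed M) G ⟩
  length G                 ≡⟨ cong length (filter-all (λ A → 2 ≤? ∣ A ∣) bigG) ⟨
  countLarge G             ≤⟨ bound G (Unique.map⁻ uL) (TwoLaminar-embed⁻ M lamL) ⟩
  m                        ∎
  where
  open ≤-Reasoning
  bigG : All (λ A → 2 ≤ ∣ A ∣) G
  bigG = gmap⁻ (λ {A} → subst (2 ≤_) (∣embed∣ M A)) bigL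

length≤1+length-filter-≢ : ∀ {X : Set} (_≟ₓ_ : DecidableEquality X) (a : X) {xs : List X} →
  Unique xs → length xs ≤ 1 + length (filter (λ x → ¬? (x ≟ₓ a)) xs)
length≤1+length-filter-≢ _≟ₓ_ a {[]}     []           = z≤n
length≤1+length-filter-≢ _≟ₓ_ a {x ∷ xs} (x∉xs ∷ uxs) with x ≟ₓ a
... | yes refl = s≤s (≤-reflexive (sym (cong length
                   (filter-all (λ y → ¬? (y ≟ₓ a)) (All.map (_∘ sym) x∉xs)))))
... | no  _    = s≤s (length≤1+length-filter-≢ _≟ₓ_ a uxs)

sum-map-mono-≤ : ∀ {X : Set} {g h : X → ℕ} → (∀ x → g x ≤ h x) →
  ∀ xs → sum (map g xs) ≤ sum (map h xs)
sum-map-mono-≤ g≤h []       = z≤n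
sum-map-mono-≤ g≤h (x ∷ xs) = +-mono-≤ (g≤h x) (sum-map-mono-≤ g≤h xs)

sum-map-constant : ∀ {X : Set} {g : X → ℕ} {c} {xs} →
  All (λ x → g x ≡ c) xs → sum (map g xs) ≡ c * length xs
sum-map-constant {c = c} []       = sym (*-zeroʳ c)
sum-map-constant {c = c} (e ∷ es) = trans (cong₂ _+_ e (sum-map-constant es)) (sym (*-suc c _))

module _ {X Y : Set} {R : X → Y → Set} (R? : ∀ x y → Dec (R x y)) (w : X → ℕ) where

  weightOn : List X → Y → ℕ
  weightOn xs y = sum (map w (filter (λ x → R? x y) xs))

  weightOn-∷-≤ : ∀ x xs y → weightOn xs y ≤ weightOn (x ∷ xs) y
  weightOn-∷-≤ x xs y with R? x y
  ... | yes _ = m≤n+m _ (w x)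
  ... | no  _ = ≤-refl

  weightOn-∷-≡ : ∀ {x y} xs → R x y → weightOn (x ∷ xs) y ≡ w x + weightOn xs y
  weightOn-∷-≡ {y = y} xs r = cong (sum ∘ map w) (filter-accept (λ x → R? x y) r)

  sum-weightOn-∷ : ∀ x xs {ys} → Any (R x) ys →
    w x + sum (map (weightOn xs) ys) ≤ sum (map (weightOn (x ∷ xs)) ys)
  sum-weightOn-∷ x xs {y ∷ ys} (here r) = begin
    w x + (weightOn xs y + sum (map (weightOn xs) ys))  ≡⟨ +-assoc (w x) _ _ ⟨
    (w x + weightOn xs y) + sum (map (weightOn xs) ys)  ≡⟨ cong (_+ _) (weightOn-∷-≡ xs r) ⟨
    weightOn (x ∷ xs) y + sum (map (weightOn xs) ys)
      ≤⟨ +-monoʳ-≤ _ (sum-map-mono-≤ (weightOn-∷-≤ x xs) ys) ⟩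
    weightOn (x ∷ xs) y + sum (map (weightOn (x ∷ xs)) ys) ∎
    where open ≤-Reasoning
  sum-weightOn-∷ x xs {y ∷ ys} (there any) = begin
    w x + (weightOn xs y + sum (map (weightOn xs) ys))  ≡⟨ x∙yz≈y∙xz (w x) (weightOn xs y) _ ⟩
    weightOn xs y + (w x + sum (map (weightOn xs) ys))
      ≤⟨ +-mono-≤ (weightOn-∷-≤ x xs y) (sum-weightOn-∷ x xs any) ⟩
    weightOn (x ∷ xs) y + sum (map (weightOn (x ∷ xs)) ys) ∎
    where open ≤-Reasoning

  sum≤sum-weightOn : ∀ {ys} xs → All (λ x → Any (R x) ys) xs →
    sum (map w xs) ≤ sum (map (weightOn xs) ys)
  sum≤sum-weightOn []       []           = z≤n
  sum≤sum-weightOn (x ∷ xs) (any ∷ anys) =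
    ≤-trans (+-monoʳ-≤ (w x) (sum≤sum-weightOn xs anys)) (sum-weightOn-∷ x xs any)

length≤sum-length-filter : ∀ {X Y : Set} {R : X → Y → Set} (R? : ∀ x y → Dec (R x y)) {ys} xs →
  All (λ x → Any (R x) ys) xs →
  length xs ≤ sum (map (λ y → length (filter (λ x → R? x y) xs)) ys)
length≤sum-length-filter R? {ys} xs covered = begin
  length xs                               ≡⟨ sum-ones xs ⟨
  sum (map (λ _ → 1) xs)                  ≤⟨ sum≤sum-weightOn R? (λ _ → 1) xs covered ⟩
  sum (map (weightOn R? (λ _ → 1) xs) ys)
    ≡⟨ cong sum (map-cong (λ y → sum-ones (filter (λ x → R? x y) xs)) ys) ⟩
  sum (map (λ y → length (filter (λ x → R? x y) xs)) ys) ∎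
  where
  open ≤-Reasoning
  sum-ones : ∀ zs → sum (map (λ _ → 1) zs) ≡ length zs
  sum-ones zs = trans (sum-map-constant (All.universal (λ _ → refl) zs)) (*-identityˡ _)

sum-map-∘≤sum-*-length-filter : ∀ {X K : Set} (_≟ₖ_ : DecidableEquality K) (g : K → ℕ) (h : X → K)
  {ks} xs → All (λ x → h x ∈ ks) xs →
  sum (map (g ∘ h) xs) ≤ sum (map (λ k → g k * length (filter (λ x → h x ≟ₖ k) xs)) ks)
sum-map-∘≤sum-*-length-filter _≟ₖ_ g h {ks} xs h[xs]⊆ks = begin
  sum (map (g ∘ h) xs)                          ≤⟨ sum≤sum-weightOn h≟ (g ∘ h) xs h[xs]⊆ks ⟩
  sum (map (weightOn h≟ (g ∘ h) xs) ks)         ≡⟨ cong sum (map-cong weight-constant ks) ⟩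
  sum (map (λ k → g k * length (filter (λ x → h x ≟ₖ k) xs)) ks) ∎
  where
  open ≤-Reasoning
  h≟ : ∀ x k → Dec (h x ≡ k)
  h≟ x k = h x ≟ₖ k
  weight-constant : ∀ k → weightOn h≟ (g ∘ h) xs k ≡ g k * length (filter (λ x → h x ≟ₖ k) xs)
  weight-constant k = sum-map-constant (All.map (cong g) (all-filter (λ x → h x ≟ₖ k) xs))

-- A largest member of F ∖ {⊤} containing A is inclusion-maximal in F ∖ {⊤}.
Fstar-above : ∀ {n} (F : List (Subset n)) {A} → A ∈ F → A ≢ ⊤ → ∃ λ M → M ∈ Fstar F × A ⊆ M
Fstar-above F {A} A∈F A≢⊤ =
  M , ∈-filter⁺ (maximalNonTop? F) M∈F (M≢⊤ , All.tabulate maximal) , A⊆M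
  where
  above? : ∀ B → Dec (A ⊆ B × B ≢ ⊤)
  above? B = (A ⊆? B) ×-dec ¬? (B ≟S ⊤)
  C : List (Subset _)
  C = filter above? F
  M : Subset _
  M = argmax ∣_∣ A C
  M∈C : M ∈ C
  M∈C = argmax-all ∣_∣ (∈-filter⁺ above? A∈F (⊆-refl , A≢⊤)) (All.tabulate (λ B∈C → B∈C))
  M∈F : M ∈ F
  M∈F = proj₁ (∈-filter⁻ above? {xs = F} M∈C)
  A⊆M : A ⊆ M
  A⊆M = proj₁ (proj₂ (∈-filter⁻ above? {xs = F} M∈C))
  M≢⊤ : M ≢ ⊤
  M≢⊤ = proj₂ (proj₂ (∈-filter⁻ above? {xs = F} M∈C))
  maximal : ∀ {B} → B ∈ F → B ≡ ⊤ ⊎ (¬ M ⊆ B ⊎ B ≡ M)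
  maximal {B} B∈F with B ≟S ⊤ | M ⊆? B
  ... | yes B≡⊤ | _        = inj₁ B≡⊤
  ... | no  _   | no  M⊈B  = inj₂ (inj₁ M⊈B)
  ... | no  B≢⊤ | yes M⊆B  = inj₂ (inj₂ (sym (p⊆q∧∣q∣≤∣p∣⇒p≡q M⊆B
          (All.lookup (f[xs]≤f[argmax] A C) (∈-filter⁺ above? B∈F (⊆-trans A⊆M M⊆B , B≢⊤))))))

∈-drop2-upTo : ∀ {m n} → 2 ≤ m → m < n → m ∈ drop 2 (upTo n)
∈-drop2-upTo {suc (suc m)} {suc (suc n)} (s≤s (s≤s _)) (s≤s (s≤s m<n)) =
  ∈-applyUpTo⁺ (suc ∘ suc) m<n

lemma3p1 : (f : ℕ → ℕ) → IsF f → (n : ℕ) → 2 ≤ n → (F : List (Subset n)) →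
    Unique F → TwoLaminar F → All (λ A → 2 ≤ ∣ A ∣) F →
    length F ≤ 1 + sum2≤k<n n (λ k → f k * b F k)
lemma3p1 f isF n _ F uF lamF bigF =
  ≤-trans (length≤1+length-filter-≢ _≟S_ ⊤ uF) (+-monoʳ-≤ 1 (begin
    length F′
      ≤⟨ length≤sum-length-filter _⊆?_ F′ covered ⟩
    sum (map (λ M → length (filter (_⊆? M) F′)) (Fstar F))
      ≤⟨ sum-map-mono-≤ inside-M-≤ (Fstar F) ⟩
    sum (map (f ∘ ∣_∣) (Fstar F))
      ≤⟨ sum-map-∘≤sum-*-length-filter _≟_ f ∣_∣ (Fstar F) sizes ⟩
    sum2≤k<n n (λ k → f k * b F k) ∎))
  where
  open ≤-Reasoning
  notTop? : ∀ A → Dec (A ≢ ⊤)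
  notTop? A = ¬? (A ≟S ⊤)
  F′ : List (Subset n)
  F′ = filter notTop? F
  covered : All (λ A → Any (A ⊆_) (Fstar F)) F′
  covered = All.tabulate λ A∈F′ → let (A∈F , A≢⊤) = ∈-filter⁻ notTop? {xs = F} A∈F′
                                      (M , M∈F* , A⊆M) = Fstar-above F A∈F A≢⊤
                                  in lose M∈F* A⊆M
  inside-M-≤ : ∀ M → length (filter (_⊆? M) F′) ≤ f ∣ M ∣
  inside-M-≤ M = TwoLaminar-⊆⇒length≤ M (isF ∣ M ∣)
    (Unique.filter⁺ (_⊆? M) (Unique.filter⁺ notTop? uF))
    (TwoLaminar-filter (_⊆? M) (TwoLaminar-filter notTop? lamF))
    (filter⁺ (_⊆? M) (filter⁺ notTop? bigF))
    (all-filter (_⊆? M) F′)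
  sizes : All (λ M → ∣ M ∣ ∈ drop 2 (upTo n)) (Fstar F)
  sizes = All.tabulate λ M∈F* → let (M∈F , M≢⊤ , _) = ∈-filter⁻ (maximalNonTop? F) {xs = F} M∈F*
                                in ∈-drop2-upTo (All.lookup bigF M∈F) (p≢⊤⇒∣p∣<n _ M≢⊤)
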